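{- Let $k\in\mathbb{N}$, let $\mathcal{S}=\{p_1,\dots,p_k\}$ be a set of $k$ distinct primes and $\mathcal{A}_{\mathcal{S}}=\{\prod_{i=1}^kp_i^{a_i}:a_1,\dots,a_k\in\mathbb{Z}_{\ge0}\}$. Let $\mathcal{A}=(q_n)_{n\in\mathbb{N}}\subseteq\mathcal{A}_{\mathcal{S}}$ be an increasing sequence of natural numbers. Then there exists a constant $C$, depending only on $k$, such that for every integer $n\ge2$, $$\sum_{m=1}^{n-1}\frac{(q_m,q_n)}{q_n}\le C,$$ where $(q_m,q_n)$ denotes the greatest common divisor. -}

module Defs where

open import Data.Nat using (ℕ; zero; suc; _*_; _^_; _<_)
open import Data.Nat.GCD using (gcd)
open import Data.Nat.Primality using (Prime)
open import Data.Fin using (Fin)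
import Data.Fin as F
open import Data.Integer using (+_)
open import Data.Rational using (ℚ; 0ℚ; _/_; _+_)
open import Data.Product using (∃)
open import Relation.Binary.PropositionalEquality using (_≡_)
open import Function.Definitions using (Injective)

prodFin : ∀ {k} → (Fin k → ℕ) → ℕ
prodFin {zero}  f = 1
prodFin {suc k} f = f F.zero * prodFin (λ i → f (F.suc i))

sumℚ : ℕ → (ℕ → ℚ) → ℚ
sumℚ zero    f = 0ℚ
sumℚ (suc n) f = sumℚ n f + f n

-- a / b as a rational; the b = 0 case never arises below (elements of A_S are ≥ 1)
ratio : ℕ → ℕ → ℚ
ratio a zero    = 0ℚ
ratio a (suc b) = (+ a) / suc b

DistinctPrimes : (k : ℕ) → (Fin k → ℕ) → Set
DistinctPrimes k p = ((i : Fin k) → Prime (p i)) × Injective _≡_ _≡_ p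
  where open import Data.Product using (_×_)

InA : ∀ {k} → (Fin k → ℕ) → ℕ → Set
InA {k} p x = ∃ λ (a : Fin k → ℕ) → x ≡ prodFin (λ i → p i ^ a i)

StrictlyIncreasing : (ℕ → ℕ) → Set
StrictlyIncreasing q = ∀ {m n} → m < n → q m < q n

module Submission where

-- Write q_n = ∏ p_i^{a_i} and q_m = ∏ p_i^{b_i} with m < n, and put
-- s = Σ_i |a_i − b_i|.  The gcd is ∏ p_i^{min(a_i,b_i)}, so q_n = gcd · V and q_m = gcd · W
-- with V = ∏ p_i^{a_i ∸ b_i} and W = ∏ p_i^{b_i ∸ a_i}.  Since q_m < q_n we get W < V, and as
-- every p_i ≥ 2 this forces V ≥ 2^{max(Σ(a∸b), Σ(b∸a))} ≥ (4/3)^s, i.e.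
--     gcd(q_m, q_n) / q_n ≤ (3/4)^s = ∏_i (3/4)^{|a_i − b_i|}.
-- The exponent vectors of q_0, …, q_{n−1} are pairwise distinct and lie in the box [0, N)^k
-- with N = q_n, so the whole sum is at most Σ over the box of ∏_i (3/4)^{|a_i − t_i|}, which
-- factors as a product of k one-dimensional two-sided geometric sums, each at most 7.
-- Hence C = 7^k works.  To stay inside ℕ every weight is scaled by 4^N per coordinate.

open import Defs
open import Data.Nat using (ℕ; _≤_)
open import Data.Nat.GCD using (gcd)
open import Data.Fin using (Fin)
import Data.Rational as Q
import Data.Integer
open import Data.Product using (∃)

open import Data.Nat
  using (zero; suc; _+_; _*_; _^_; _∸_; _⊓_; _⊔_; _<_; ∣_-_∣; z≤n; s≤s; NonZero)
open import Data.Nat.Properties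
open import Data.Nat.Base using (nonTrivial⇒n>1; nonTrivial⇒≢1)
open import Data.Nat.Divisibility using (_∣_; ∣-antisym; ∣-trans; ∣1⇒≡1; ∣n⇒∣m*n)
open import Data.Nat.GCD
  using (gcd-comm; gcd-greatest; gcd[m,n]∣m; gcd[m,n]∣n; c*gcd[m,n]≡gcd[cm,cn])
open import Data.Nat.Coprimality using (Coprime; coprime-divisor)
open import Data.Nat.Primality
  using (Prime; euclidsLemma; prime⇒irreducible; prime⇒nonTrivial)
open import Data.Nat.ListAction using (sum)
open import Data.Nat.ListAction.Properties using (sum-++)
import Data.Fin as F
import Data.Fin.Properties as FP
open import Data.Vec using (Vec; []; _∷_; lookup; tabulate)
open import Data.Vec.Properties using (lookup∘tabulate; ≡-dec)
open import Data.List using (List; []; _∷_; _++_; map; downFrom; cartesianProductWith)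
open import Data.List.Properties using (map-++)
open import Data.List.Membership.Propositional using (_∈_)
open import Data.List.Membership.Propositional.Properties
  using (∈-downFrom⁺; ∈-cartesianProductWith⁺)
open import Data.List.Relation.Unary.Any using (here; there)
open import Data.Product using (_,_; proj₁; proj₂)
open import Data.Sum using (inj₁; inj₂)
open import Data.Empty using (⊥-elim)
open import Function using (_∘_)
open import Relation.Nullary using (¬_; yes; no)
open import Relation.Binary.Definitions using (DecidableEquality)
open import Relation.Binary.PropositionalEquality
import Data.Integer as ℤ
import Data.Integer.Properties as ℤP
import Data.Rational.Properties as QP
open import Data.Rational.Unnormalised as ℚᵘ using (mkℚᵘ; *≡*; *≤*)
import Data.Rational.Unnormalised.Properties as ℚᵘP
open import Algebra.Properties.CommutativeSemigroup +-commutativeSemigroup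
  renaming (interchange to +-interchange; x∙yz≈y∙xz to +-comm-middle)
  using ()
open import Data.Nat.Solver using (module +-*-Solver)
open +-*-Solver using (solve; _:+_; _:*_; _:=_; con)

sumFin : ∀ {k} → (Fin k → ℕ) → ℕ
sumFin {zero}  f = 0
sumFin {suc k} f = f F.zero + sumFin (f ∘ F.suc)

sumFin-cong : ∀ {k} {f g : Fin k → ℕ} → (∀ i → f i ≡ g i) → sumFin f ≡ sumFin g
sumFin-cong {zero}  f≗g = refl
sumFin-cong {suc k} f≗g = cong₂ _+_ (f≗g F.zero) (sumFin-cong (f≗g ∘ F.suc))

sumFin-+ : ∀ {k} (f g : Fin k → ℕ) → sumFin (λ i → f i + g i) ≡ sumFin f + sumFin g
sumFin-+ {zero}  f g = refl
sumFin-+ {suc k} f g = trans (cong (f F.zero + g F.zero +_) (sumFin-+ (f ∘ F.suc) (g ∘ F.suc)))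
  (+-interchange (f F.zero) (g F.zero) (sumFin (f ∘ F.suc)) (sumFin (g ∘ F.suc)))

≤-sumFin : ∀ {k} (f : Fin k → ℕ) i → f i ≤ sumFin f
≤-sumFin f F.zero    = m≤m+n (f F.zero) _
≤-sumFin f (F.suc i) = ≤-trans (≤-sumFin (f ∘ F.suc) i) (m≤n+m _ (f F.zero))

prodFin-cong : ∀ {k} {f g : Fin k → ℕ} → (∀ i → f i ≡ g i) → prodFin f ≡ prodFin g
prodFin-cong {zero}  f≗g = refl
prodFin-cong {suc k} f≗g = cong₂ _*_ (f≗g F.zero) (prodFin-cong (f≗g ∘ F.suc))

prodFin-mono : ∀ {k} {f g : Fin k → ℕ} → (∀ i → f i ≤ g i) → prodFin f ≤ prodFin g
prodFin-mono {zero}  f≤g = ≤-refl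
prodFin-mono {suc k} f≤g = *-mono-≤ (f≤g F.zero) (prodFin-mono (f≤g ∘ F.suc))

prodFin-* : ∀ {k} (f g : Fin k → ℕ) → prodFin (λ i → f i * g i) ≡ prodFin f * prodFin g
prodFin-* {zero}  f g = refl
prodFin-* {suc k} f g = trans (cong (f F.zero * g F.zero *_) (prodFin-* (f ∘ F.suc) (g ∘ F.suc)))
  ([m*n]*[o*p]≡[m*o]*[n*p] (f F.zero) (g F.zero) (prodFin (f ∘ F.suc)) (prodFin (g ∘ F.suc)))

prodFin-const : ∀ k c → prodFin {k} (λ _ → c) ≡ c ^ k
prodFin-const zero    c = refl
prodFin-const (suc k) c = cong (c *_) (prodFin-const k c)

prodFin-^ : ∀ {k} c (f : Fin k → ℕ) → prodFin (λ i → c ^ f i) ≡ c ^ sumFin f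
prodFin-^ {zero}  c f = refl
prodFin-^ {suc k} c f = trans (cong (c ^ f F.zero *_) (prodFin-^ c (f ∘ F.suc)))
  (sym (^-distribˡ-+-* c (f F.zero) (sumFin (f ∘ F.suc))))

-- Σ_{m<n} f m, summed in the same order as sumℚ.
sum< : ℕ → (ℕ → ℕ) → ℕ
sum< zero    f = 0
sum< (suc n) f = sum< n f + f n

sum<-*ˡ : ∀ c n (f : ℕ → ℕ) → c * sum< n f ≡ sum< n (λ m → c * f m)
sum<-*ˡ c zero    f = *-zeroʳ c
sum<-*ˡ c (suc n) f = trans (*-distribˡ-+ c (sum< n f) (f n)) (cong (_+ c * f n) (sum<-*ˡ c n f))

sum<-mono : ∀ n {f g : ℕ → ℕ} → (∀ m → m < n → f m ≤ g m) → sum< n f ≤ sum< n g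
sum<-mono zero    f≤g = z≤n
sum<-mono (suc n) f≤g = +-mono-≤ (sum<-mono n (λ m m<n → f≤g m (m<n⇒m<1+n m<n))) (f≤g n ≤-refl)

sum<-cong : ∀ n {f g : ℕ → ℕ} → (∀ m → f m ≡ g m) → sum< n f ≡ sum< n g
sum<-cong zero    f≗g = refl
sum<-cong (suc n) f≗g = cong₂ _+_ (sum<-cong n f≗g) (f≗g n)

sum-downFrom : ∀ N (h : ℕ → ℕ) → sum (map h (downFrom N)) ≡ sum< N h
sum-downFrom zero    h = refl
sum-downFrom (suc N) h = trans (cong (h N +_) (sum-downFrom N h)) (+-comm (h N) (sum< N h))

monomial : ∀ {k} → (Fin k → ℕ) → (Fin k → ℕ) → ℕ
monomial p a = prodFin (λ i → p i ^ a i)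

monomial-cong : ∀ {k} (p : Fin k → ℕ) {a b : Fin k → ℕ} → (∀ i → a i ≡ b i) →
  monomial p a ≡ monomial p b
monomial-cong p a≗b = prodFin-cong (λ i → cong (p i ^_) (a≗b i))

monomial-+ : ∀ {k} (p a b : Fin k → ℕ) →
  monomial p (λ i → a i + b i) ≡ monomial p a * monomial p b
monomial-+ p a b = trans (prodFin-cong (λ i → ^-distribˡ-+-* (p i) (a i) (b i)))
  (prodFin-* (λ i → p i ^ a i) (λ i → p i ^ b i))

monomial-split : ∀ {k} (p a b : Fin k → ℕ) →
  monomial p a ≡ monomial p (λ i → b i ⊓ a i) * monomial p (λ i → a i ∸ b i)
monomial-split p a b = trans (monomial-cong p (λ i → sym (m⊓n+n∸m≡n (b i) (a i))))
  (monomial-+ p (λ i → b i ⊓ a i) (λ i → a i ∸ b i))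

-- Every prime is at least 2; this is the only size information used about the p_i.
prime≥2 : ∀ {P} → Prime P → 2 ≤ P
prime≥2 {P} pr = nonTrivial⇒n>1 P {{prime⇒nonTrivial pr}}

2^deg≤monomial : ∀ {k} {p : Fin k → ℕ} → (∀ i → 2 ≤ p i) → ∀ a → 2 ^ sumFin a ≤ monomial p a
2^deg≤monomial {p = p} p≥2 a = subst (_≤ monomial p a) (prodFin-^ 2 a)
  (prodFin-mono (λ i → ^-monoˡ-≤ (a i) (p≥2 i)))

n<2^n : ∀ n → n < 2 ^ n
n<2^n zero    = s≤s z≤n
n<2^n (suc n) = subst (suc (suc n) ≤_) (cong (2 ^ n +_) (sym (+-identityʳ (2 ^ n))))
  (+-mono-≤ (m^n>0 2 n) (n<2^n n))

-- Every exponent is smaller than the monomial itself; used to put exponents in a finite box.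
exponent<monomial : ∀ {k} {p : Fin k → ℕ} → (∀ i → 2 ≤ p i) → ∀ a i → a i < monomial p a
exponent<monomial p≥2 a i =
  <-≤-trans (≤-<-trans (≤-sumFin a i) (n<2^n (sumFin a))) (2^deg≤monomial p≥2 a)

InA⇒>0 : ∀ {k} {p : Fin k → ℕ} → (∀ i → Prime (p i)) → ∀ {x} → InA p x → 0 < x
InA⇒>0 ps (a , refl) = <-≤-trans (m^n>0 2 (sumFin a)) (2^deg≤monomial (prime≥2 ∘ ps) a)

prime∤⇒coprime : ∀ {P n} → Prime P → ¬ P ∣ n → Coprime P n
prime∤⇒coprime pr P∤n (d∣P , d∣n) with prime⇒irreducible pr d∣P
... | inj₁ d≡1  = d≡1
... | inj₂ refl = ⊥-elim (P∤n d∣n)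

gcd-cancel-coprime : ∀ {c} m n → Coprime c n → gcd (c * m) n ≡ gcd m n
gcd-cancel-coprime {c} m n c⊥n = ∣-antisym
  (gcd-greatest (coprime-divisor g⊥c (gcd[m,n]∣m (c * m) n)) (gcd[m,n]∣n (c * m) n))
  (gcd-greatest (∣n⇒∣m*n c (gcd[m,n]∣m m n)) (gcd[m,n]∣n m n))
  where
  g⊥c : Coprime (gcd (c * m) n) c
  g⊥c (d∣g , d∣c) = c⊥n (d∣c , ∣-trans d∣g (gcd[m,n]∣n (c * m) n))

gcd-cancel-prime-power : ∀ {P} → Prime P → ∀ e m n → ¬ P ∣ n → gcd (P ^ e * m) n ≡ gcd m n
gcd-cancel-prime-power pr zero m n P∤n = cong (λ x → gcd x n) (*-identityˡ m)
gcd-cancel-prime-power {P} pr (suc e) m n P∤n = begin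
  gcd (P * P ^ e * m) n   ≡⟨ cong (λ x → gcd x n) (*-assoc P (P ^ e) m) ⟩
  gcd (P * (P ^ e * m)) n ≡⟨ gcd-cancel-coprime (P ^ e * m) n (prime∤⇒coprime pr P∤n) ⟩
  gcd (P ^ e * m) n       ≡⟨ gcd-cancel-prime-power pr e m n P∤n ⟩
  gcd m n                 ∎
  where open ≡-Reasoning

gcd-prime-power-part : ∀ {P} → Prime P → ∀ e f {m n} → ¬ P ∣ m → ¬ P ∣ n →
  gcd (P ^ e * m) (P ^ f * n) ≡ P ^ (e ⊓ f) * gcd m n
gcd-prime-power-part {P} pr zero f {m} {n} P∤m P∤n = begin
  gcd (1 * m) (P ^ f * n) ≡⟨ cong (λ x → gcd x (P ^ f * n)) (*-identityˡ m) ⟩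
  gcd m (P ^ f * n)       ≡⟨ gcd-comm m (P ^ f * n) ⟩
  gcd (P ^ f * n) m       ≡⟨ gcd-cancel-prime-power pr f n m P∤m ⟩
  gcd n m                 ≡⟨ gcd-comm n m ⟩
  gcd m n                 ≡⟨ *-identityˡ (gcd m n) ⟨
  1 * gcd m n             ∎
  where open ≡-Reasoning
gcd-prime-power-part {P} pr (suc e) zero {m} {n} P∤m P∤n = begin
  gcd (P ^ suc e * m) (1 * n) ≡⟨ cong (gcd (P ^ suc e * m)) (*-identityˡ n) ⟩
  gcd (P ^ suc e * m) n       ≡⟨ gcd-cancel-prime-power pr (suc e) m n P∤n ⟩
  gcd m n                     ≡⟨ *-identityˡ (gcd m n) ⟨
  1 * gcd m n                 ∎
  where open ≡-Reasoning
gcd-prime-power-part {P} pr (suc e) (suc f) {m} {n} P∤m P∤n = begin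
  gcd (P * P ^ e * m) (P * P ^ f * n)     ≡⟨ cong₂ gcd (*-assoc P (P ^ e) m) (*-assoc P (P ^ f) n) ⟩
  gcd (P * (P ^ e * m)) (P * (P ^ f * n)) ≡⟨ c*gcd[m,n]≡gcd[cm,cn] P (P ^ e * m) (P ^ f * n) ⟨
  P * gcd (P ^ e * m) (P ^ f * n)         ≡⟨ cong (P *_) (gcd-prime-power-part pr e f P∤m P∤n) ⟩
  P * (P ^ (e ⊓ f) * gcd m n)             ≡⟨ *-assoc P (P ^ (e ⊓ f)) (gcd m n) ⟨
  P * P ^ (e ⊓ f) * gcd m n               ∎
  where open ≡-Reasoning

P≢1 : ∀ {P} → Prime P → P ≢ 1
P≢1 pr = nonTrivial⇒≢1 {{prime⇒nonTrivial pr}}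

prime∣prime^⇒≡ : ∀ {P q} → Prime P → Prime q → ∀ e → P ∣ q ^ e → P ≡ q
prime∣prime^⇒≡ pr qr zero P∣1 = ⊥-elim (P≢1 pr (∣1⇒≡1 P∣1))
prime∣prime^⇒≡ {q = q} pr qr (suc e) P∣q^[1+e] with euclidsLemma q (q ^ e) pr P∣q^[1+e]
... | inj₂ P∣q^e = prime∣prime^⇒≡ pr qr e P∣q^e
... | inj₁ P∣q with prime⇒irreducible qr P∣q
...   | inj₁ P≡1 = ⊥-elim (P≢1 pr P≡1)
...   | inj₂ P≡q = P≡q

prime∤monomial : ∀ {k P} {p : Fin k → ℕ} → Prime P → (∀ i → Prime (p i)) → (∀ i → P ≢ p i) →
  ∀ a → ¬ P ∣ monomial p a
prime∤monomial {zero} pr _ _ a P∣1 = P≢1 pr (∣1⇒≡1 P∣1)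
prime∤monomial {suc k} {p = p} pr ps P≢p a P∣p^a
  with euclidsLemma (p F.zero ^ a F.zero) (monomial (p ∘ F.suc) (a ∘ F.suc)) pr P∣p^a
... | inj₁ P∣p₀^a₀ = P≢p F.zero (prime∣prime^⇒≡ pr (ps F.zero) (a F.zero) P∣p₀^a₀)
... | inj₂ P∣rest  = prime∤monomial pr (ps ∘ F.suc) (P≢p ∘ F.suc) (a ∘ F.suc) P∣rest

gcd-monomial : ∀ {k} {p : Fin k → ℕ} → DistinctPrimes k p → ∀ a b →
  gcd (monomial p a) (monomial p b) ≡ monomial p (λ i → a i ⊓ b i)
gcd-monomial {zero} _ a b = refl
gcd-monomial {suc k} {p} (ps , p-inj) a b = begin
  gcd (P ^ a F.zero * monomial p′ a′) (P ^ b F.zero * monomial p′ b′)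
    ≡⟨ gcd-prime-power-part (ps F.zero) (a F.zero) (b F.zero) (P∤ a′) (P∤ b′) ⟩
  P ^ (a F.zero ⊓ b F.zero) * gcd (monomial p′ a′) (monomial p′ b′)
    ≡⟨ cong (P ^ (a F.zero ⊓ b F.zero) *_) (gcd-monomial distinct′ a′ b′) ⟩
  P ^ (a F.zero ⊓ b F.zero) * monomial p′ (λ i → a′ i ⊓ b′ i) ∎
  where
  open ≡-Reasoning
  P = p F.zero
  p′ = p ∘ F.suc
  a′ = a ∘ F.suc
  b′ = b ∘ F.suc
  distinct′ : DistinctPrimes k p′
  distinct′ = ps ∘ F.suc , λ eq → FP.suc-injective (p-inj eq)
  P∤ : ∀ e → ¬ P ∣ monomial p′ e
  P∤ = prime∤monomial (ps F.zero) (ps ∘ F.suc) (λ i eq → FP.0≢1+n (p-inj eq))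

dist₁ : ∀ {k} → (Fin k → ℕ) → (Fin k → ℕ) → ℕ
dist₁ a b = sumFin (λ i → ∣ a i - b i ∣)

∣m-n∣≡[m∸n]+[n∸m] : ∀ m n → ∣ m - n ∣ ≡ (m ∸ n) + (n ∸ m)
∣m-n∣≡[m∸n]+[n∸m] zero    zero    = refl
∣m-n∣≡[m∸n]+[n∸m] zero    (suc n) = refl
∣m-n∣≡[m∸n]+[n∸m] (suc m) zero    = sym (+-identityʳ (suc m))
∣m-n∣≡[m∸n]+[n∸m] (suc m) (suc n) = ∣m-n∣≡[m∸n]+[n∸m] m n

4^≤3^*2^ : ∀ d → 4 ^ d ≤ 3 ^ d * 2 ^ d
4^≤3^*2^ zero    = ≤-refl
4^≤3^*2^ (suc d) = begin
  4 * 4 ^ d           ≤⟨ *-mono-≤ (m≤m+n 4 2) (4^≤3^*2^ d) ⟩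
  6 * (3 ^ d * 2 ^ d) ≡⟨ [m*n]*[o*p]≡[m*o]*[n*p] 3 2 (3 ^ d) (2 ^ d) ⟩
  3 * 3 ^ d * (2 * 2 ^ d) ∎
  where open ≤-Reasoning

-- Since c + d ≤ 2·max(c,d) and 16 ≤ 2·9: (4/3)^(c+d) ≤ 2^max(c,d).
4^≤3^*2^max : ∀ c d → 4 ^ (c + d) ≤ 3 ^ (c + d) * 2 ^ (c ⊔ d)
4^≤3^*2^max zero    d       = 4^≤3^*2^ d
4^≤3^*2^max (suc c) zero    =
  subst (λ s → 4 ^ s ≤ 3 ^ s * 2 ^ suc c) (sym (+-identityʳ (suc c))) (4^≤3^*2^ (suc c))
4^≤3^*2^max (suc c) (suc d) = begin
  4 ^ (suc c + suc d)       ≡⟨ cong (4 ^_) (cong suc (+-suc c d)) ⟩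
  4 * (4 * 4 ^ (c + d))     ≡⟨ *-assoc 4 4 (4 ^ (c + d)) ⟨
  16 * 4 ^ (c + d)          ≤⟨ *-mono-≤ (m≤m+n 16 2) (4^≤3^*2^max c d) ⟩
  18 * X                    ≡⟨ solve 2 (λ x y → con 18 :* (x :* y) := con 3 :* (con 3 :* x) :* (con 2 :* y))
                                 refl (3 ^ (c + d)) (2 ^ (c ⊔ d)) ⟩
  3 ^ (2 + (c + d)) * 2 ^ (suc c ⊔ suc d) ≡⟨ cong (λ s → 3 ^ suc s * 2 ^ (suc c ⊔ suc d)) (+-suc c d) ⟨
  3 ^ (suc c + suc d) * 2 ^ (suc c ⊔ suc d) ∎
  where
  open ≤-Reasoning
  X = 3 ^ (c + d) * 2 ^ (c ⊔ d)

2^⊔≤ : ∀ c d {V} → 2 ^ c ≤ V → 2 ^ d ≤ V → 2 ^ (c ⊔ d) ≤ V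
2^⊔≤ c d 2^c≤V 2^d≤V with ⊔-sel c d
... | inj₁ c⊔d≡c = subst (λ e → 2 ^ e ≤ _) (sym c⊔d≡c) 2^c≤V
... | inj₂ c⊔d≡d = subst (λ e → 2 ^ e ≤ _) (sym c⊔d≡d) 2^d≤V

gcd-decay : ∀ {k} {p : Fin k → ℕ} → DistinctPrimes k p → ∀ a b → monomial p b < monomial p a →
  4 ^ dist₁ a b * gcd (monomial p b) (monomial p a) ≤ 3 ^ dist₁ a b * monomial p a
gcd-decay {p = p} dp@(ps , _) a b x<y = begin
  4 ^ s * g                          ≡⟨ cong (λ e → 4 ^ e * g) s≡ ⟩
  4 ^ (sc + sd) * g                  ≤⟨ *-monoˡ-≤ g (4^≤3^*2^max sc sd) ⟩
  3 ^ (sc + sd) * 2 ^ (sc ⊔ sd) * g  ≤⟨ *-monoˡ-≤ g (*-monoʳ-≤ (3 ^ (sc + sd)) 2^max≤V) ⟩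
  3 ^ (sc + sd) * V * g              ≡⟨ *-assoc (3 ^ (sc + sd)) V g ⟩
  3 ^ (sc + sd) * (V * g)            ≡⟨ cong₂ (λ e z → 3 ^ e * z) (sym s≡) (*-comm V g) ⟩
  3 ^ s * (g * V)                    ≡⟨ cong (3 ^ s *_) y≡gV ⟨
  3 ^ s * monomial p a               ∎
  where
  open ≤-Reasoning
  c = λ i → a i ∸ b i
  d = λ i → b i ∸ a i
  s = dist₁ a b
  sc = sumFin c
  sd = sumFin d
  g = gcd (monomial p b) (monomial p a)
  V = monomial p c
  W = monomial p d
  p≥2 : ∀ i → 2 ≤ p i
  p≥2 i = prime≥2 (ps i)
  s≡ : s ≡ sc + sd
  s≡ = trans (sumFin-cong (λ i → ∣m-n∣≡[m∸n]+[n∸m] (a i) (b i))) (sumFin-+ c d)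
  y≡gV : monomial p a ≡ g * V
  y≡gV = trans (monomial-split p a b) (cong (_* V) (sym (gcd-monomial dp b a)))
  x≡gW : monomial p b ≡ g * W
  x≡gW = trans (monomial-split p b a) (cong (_* W) (sym (trans (gcd-monomial dp b a)
           (monomial-cong p (λ i → ⊓-comm (b i) (a i))))))
  W<V : W < V
  W<V = *-cancelˡ-< g W V (subst₂ _<_ x≡gW y≡gV x<y)
  2^max≤V : 2 ^ (sc ⊔ sd) ≤ V
  2^max≤V = 2^⊔≤ sc sd (2^deg≤monomial p≥2 c) (≤-trans (2^deg≤monomial p≥2 d) (<⇒≤ W<V))

sum-cartesianProductWith : ∀ {A B C : Set} (g : A → B → C) (f : C → ℕ) (h₁ : A → ℕ) (h₂ : B → ℕ) →
  (∀ x y → f (g x y) ≡ h₁ x * h₂ y) → ∀ xs ys →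
  sum (map f (cartesianProductWith g xs ys)) ≡ sum (map h₁ xs) * sum (map h₂ ys)
sum-cartesianProductWith g f h₁ h₂ f≡ []       ys = refl
sum-cartesianProductWith g f h₁ h₂ f≡ (x ∷ xs) ys = begin
  sum (map f (map (g x) ys ++ cartesianProductWith g xs ys))
    ≡⟨ cong sum (map-++ f (map (g x) ys) (cartesianProductWith g xs ys)) ⟩
  sum (map f (map (g x) ys) ++ map f (cartesianProductWith g xs ys))
    ≡⟨ sum-++ (map f (map (g x) ys)) (map f (cartesianProductWith g xs ys)) ⟩
  sum (map f (map (g x) ys)) + sum (map f (cartesianProductWith g xs ys))
    ≡⟨ cong₂ _+_ (row ys) (sum-cartesianProductWith g f h₁ h₂ f≡ xs ys) ⟩
  h₁ x * S₂ + sum (map h₁ xs) * S₂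
    ≡⟨ *-distribʳ-+ S₂ (h₁ x) (sum (map h₁ xs)) ⟨
  (h₁ x + sum (map h₁ xs)) * S₂ ∎
  where
  open ≡-Reasoning
  S₂ = sum (map h₂ ys)
  row : ∀ zs → sum (map f (map (g x) zs)) ≡ h₁ x * sum (map h₂ zs)
  row []       = sym (*-zeroʳ (h₁ x))
  row (z ∷ zs) = trans (cong₂ _+_ (f≡ x z) (row zs)) (sym (*-distribˡ-+ (h₁ x) (h₂ z) _))

module InjectiveSum {A : Set} (_≟ᴬ_ : DecidableEquality A) (f : A → ℕ) where

  remove : A → List A → List A
  remove x [] = []
  remove x (y ∷ ys) with y ≟ᴬ x
  ... | yes _ = remove x ys
  ... | no  _ = y ∷ remove x ys

  sum-remove≤ : ∀ x ys → sum (map f (remove x ys)) ≤ sum (map f ys)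
  sum-remove≤ x [] = ≤-refl
  sum-remove≤ x (y ∷ ys) with y ≟ᴬ x
  ... | yes _ = ≤-trans (sum-remove≤ x ys) (m≤n+m _ (f y))
  ... | no  _ = +-monoʳ-≤ (f y) (sum-remove≤ x ys)

  sum-remove : ∀ {x} ys → x ∈ ys → f x + sum (map f (remove x ys)) ≤ sum (map f ys)
  sum-remove {x} (y ∷ ys) x∈ with y ≟ᴬ x
  ... | yes refl = +-monoʳ-≤ (f y) (sum-remove≤ x ys)
  sum-remove (y ∷ ys) (here refl) | no y≢x = ⊥-elim (y≢x refl)
  sum-remove {x} (y ∷ ys) (there x∈ys) | no y≢x = begin
    f x + (f y + sum (map f (remove x ys))) ≡⟨ +-comm-middle (f x) (f y) (sum (map f (remove x ys))) ⟩
    f y + (f x + sum (map f (remove x ys))) ≤⟨ +-monoʳ-≤ (f y) (sum-remove ys x∈ys) ⟩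
    f y + sum (map f ys)                    ∎
    where open ≤-Reasoning

  ∈-remove : ∀ {x z} ys → z ∈ ys → z ≢ x → z ∈ remove x ys
  ∈-remove {x} (y ∷ ys) z∈ z≢x with y ≟ᴬ x
  ∈-remove (y ∷ ys) (here refl)  z≢x | yes y≡x = ⊥-elim (z≢x y≡x)
  ∈-remove (y ∷ ys) (there z∈ys) z≢x | yes _   = ∈-remove ys z∈ys z≢x
  ∈-remove (y ∷ ys) (here refl)  z≢x | no _    = here refl
  ∈-remove (y ∷ ys) (there z∈ys) z≢x | no _    = there (∈-remove ys z∈ys z≢x)

  -- Induction on n: the last point v n is charged to its occurrence in M, the others to
  -- M with v n deleted.
  sum-injective≤ : ∀ (v : ℕ → A) n M → (∀ m → m < n → v m ∈ M) →
    (∀ {m m′} → m < m′ → m′ < n → v m ≢ v m′) → sum< n (f ∘ v) ≤ sum (map f M)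
  sum-injective≤ v zero    M v∈M v-inj = z≤n
  sum-injective≤ v (suc n) M v∈M v-inj = begin
    sum< n (f ∘ v) + f (v n)                ≤⟨ +-monoˡ-≤ (f (v n)) rest≤ ⟩
    sum (map f (remove (v n) M)) + f (v n)  ≡⟨ +-comm _ (f (v n)) ⟩
    f (v n) + sum (map f (remove (v n) M))  ≤⟨ sum-remove M (v∈M n ≤-refl) ⟩
    sum (map f M)                           ∎
    where
    open ≤-Reasoning
    rest≤ : sum< n (f ∘ v) ≤ sum (map f (remove (v n) M))
    rest≤ = sum-injective≤ v n (remove (v n) M)
      (λ m m<n → ∈-remove M (v∈M m (m<n⇒m<1+n m<n)) (v-inj m<n ≤-refl))
      (λ m<m′ m′<n → v-inj m<m′ (m<n⇒m<1+n m′<n))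

∸-suc : ∀ {m n} → suc n ≤ m → m ∸ n ≡ suc (m ∸ suc n)
∸-suc {m} 1+n≤m = +-∸-assoc 1 {m} 1+n≤m

-- Fix a bound N for all exponents.  weight j = 4^N · (3/4)^j is a natural number for j ≤ N.
module Weights (N : ℕ) where

  weight : ℕ → ℕ
  weight j = 3 ^ j * 4 ^ (N ∸ j)

  weight-step : ∀ {j} → suc j ≤ N → 4 * weight (suc j) ≡ 3 * weight j
  weight-step {j} j<N = begin
    4 * (3 * 3 ^ j * 4 ^ (N ∸ suc j))   ≡⟨ solve 2 (λ x y → con 4 :* (con 3 :* x :* y) := con 3 :* (x :* (con 4 :* y)))
                                             refl (3 ^ j) (4 ^ (N ∸ suc j)) ⟩
    3 * (3 ^ j * 4 ^ suc (N ∸ suc j))   ≡⟨ cong (λ e → 3 * (3 ^ j * 4 ^ e)) (∸-suc j<N) ⟨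
    3 * weight j                        ∎
    where open ≡-Reasoning

  weight-from : ℕ → ℕ → ℕ
  weight-from α t = weight ∣ α - t ∣

  left-tail : ∀ α B → B ≤ α → α ≤ N → sum< B (weight-from α) ≤ 3 * weight (α ∸ B)
  left-tail α zero    _     _   = z≤n
  left-tail α (suc B) 1+B≤α α≤N = begin
    sum< B (weight-from α) + weight ∣ α - B ∣ ≡⟨ cong (λ j → sum< B (weight-from α) + weight j) (m≤n⇒∣n-m∣≡n∸m B≤α) ⟩
    sum< B (weight-from α) + weight (α ∸ B)   ≤⟨ +-monoˡ-≤ (weight (α ∸ B)) (left-tail α B B≤α α≤N) ⟩
    3 * weight (α ∸ B) + weight (α ∸ B)       ≡⟨ +-comm (3 * weight (α ∸ B)) (weight (α ∸ B)) ⟩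
    4 * weight (α ∸ B)                        ≡⟨ cong (λ j → 4 * weight j) (∸-suc 1+B≤α) ⟩
    4 * weight (suc (α ∸ suc B))              ≡⟨ weight-step 1+j≤N ⟩
    3 * weight (α ∸ suc B)                    ∎
    where
    open ≤-Reasoning
    B≤α = <⇒≤ 1+B≤α
    1+j≤N : suc (α ∸ suc B) ≤ N
    1+j≤N = subst (_≤ N) (∸-suc 1+B≤α) (≤-trans (m∸n≤m α B) α≤N)

  -- Right of the centre, carrying the geometric remainder 4 · weight e along.
  right-tail : ∀ α e → α + e ≤ N → sum< (α + e) (weight-from α) + 4 * weight e ≤ 7 * 4 ^ N
  right-tail α zero α+0≤N = begin
    sum< (α + 0) (weight-from α) + 4 * weight 0 ≡⟨ cong (λ B → sum< B (weight-from α) + 4 * weight 0) (+-identityʳ α) ⟩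
    sum< α (weight-from α) + 4 * weight 0       ≤⟨ +-monoˡ-≤ (4 * weight 0) (left-tail α α ≤-refl α≤N) ⟩
    3 * weight (α ∸ α) + 4 * weight 0           ≡⟨ cong (λ j → 3 * weight j + 4 * weight 0) (n∸n≡0 α) ⟩
    3 * weight 0 + 4 * weight 0                 ≡⟨ *-distribʳ-+ (weight 0) 3 4 ⟨
    7 * weight 0                                ≡⟨ cong (7 *_) (*-identityˡ (4 ^ N)) ⟩
    7 * 4 ^ N                                   ∎
    where
    open ≤-Reasoning
    α≤N = subst (_≤ N) (+-identityʳ α) α+0≤N
  right-tail α (suc e) α+1+e≤N = begin
    sum< (α + suc e) (weight-from α) + 4 * weight (suc e)
      ≡⟨ cong (λ B → sum< B (weight-from α) + 4 * weight (suc e)) (+-suc α e) ⟩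
    sum< (α + e) (weight-from α) + weight ∣ α - α + e ∣ + 4 * weight (suc e)
      ≡⟨ cong₂ (λ j z → sum< (α + e) (weight-from α) + weight j + z) (∣m-m+n∣≡n α e) (weight-step 1+e≤N) ⟩
    sum< (α + e) (weight-from α) + weight e + 3 * weight e
      ≡⟨ +-assoc (sum< (α + e) (weight-from α)) (weight e) (3 * weight e) ⟩
    sum< (α + e) (weight-from α) + 4 * weight e
      ≤⟨ right-tail α e (≤-trans (n≤1+n (α + e)) 1+α+e≤N) ⟩
    7 * 4 ^ N ∎
    where
    open ≤-Reasoning
    1+α+e≤N = subst (_≤ N) (+-suc α e) α+1+e≤N
    1+e≤N = ≤-trans (m≤n+m (suc e) α) α+1+e≤N

  line-sum : ∀ {α} → α ≤ N → sum< N (weight-from α) ≤ 7 * 4 ^ N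
  line-sum {α} α≤N = begin
    sum< N (weight-from α)                   ≡⟨ cong (λ B → sum< B (weight-from α)) (m+[n∸m]≡n α≤N) ⟨
    sum< (α + (N ∸ α)) (weight-from α)       ≤⟨ m≤m+n _ (4 * weight (N ∸ α)) ⟩
    sum< (α + (N ∸ α)) (weight-from α) + 4 * weight (N ∸ α)
                                             ≤⟨ right-tail α (N ∸ α) (≤-reflexive (m+[n∸m]≡n α≤N)) ⟩
    7 * 4 ^ N                                ∎
    where open ≤-Reasoning

  point-weight : ∀ {k} → (Fin k → ℕ) → Vec ℕ k → ℕ
  point-weight a t = prodFin (λ i → weight-from (a i) (lookup t i))

  box : ∀ k → List (Vec ℕ k)
  box zero    = [] ∷ []
  box (suc k) = cartesianProductWith _∷_ (downFrom N) (box k)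

  ∈-box : ∀ {k} (b : Fin k → ℕ) → (∀ i → b i < N) → tabulate b ∈ box k
  ∈-box {zero}  b b<N = here refl
  ∈-box {suc k} b b<N =
    ∈-cartesianProductWith⁺ _∷_ (∈-downFrom⁺ (b<N F.zero)) (∈-box (b ∘ F.suc) (b<N ∘ F.suc))

  box-sum : ∀ {k} (a : Fin k → ℕ) →
    sum (map (point-weight a) (box k)) ≡ prodFin (λ i → sum< N (weight-from (a i)))
  box-sum {zero}  a = refl
  box-sum {suc k} a = trans
    (sum-cartesianProductWith _∷_ (point-weight a) (weight-from (a F.zero)) (point-weight (a ∘ F.suc))
      (λ _ _ → refl) (downFrom N) (box k))
    (cong₂ _*_ (sum-downFrom N (weight-from (a F.zero))) (box-sum (a ∘ F.suc)))

  box-sum≤ : ∀ {k} (a : Fin k → ℕ) → (∀ i → a i ≤ N) →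
    sum (map (point-weight a) (box k)) ≤ 7 ^ k * (4 ^ N) ^ k
  box-sum≤ {k} a a≤N = begin
    sum (map (point-weight a) (box k))       ≡⟨ box-sum a ⟩
    prodFin (λ i → sum< N (weight-from (a i))) ≤⟨ prodFin-mono (λ i → line-sum (a≤N i)) ⟩
    prodFin {k} (λ _ → 7 * 4 ^ N)            ≡⟨ prodFin-* {k} (λ _ → 7) (λ _ → 4 ^ N) ⟩
    prodFin {k} (λ _ → 7) * prodFin {k} (λ _ → 4 ^ N)
                                             ≡⟨ cong₂ _*_ (prodFin-const k 7) (prodFin-const k (4 ^ N)) ⟩
    7 ^ k * (4 ^ N) ^ k                      ∎
    where open ≤-Reasoning

  -- gcd-decay multiplied by (4^N)^k: every factor 4^N · (3/4)^|a_i − b_i| is then an integer.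
  scaled-decay : ∀ {k} {p : Fin k → ℕ} → DistinctPrimes k p → ∀ a b →
    (∀ i → ∣ a i - b i ∣ ≤ N) → monomial p b < monomial p a →
    (4 ^ N) ^ k * gcd (monomial p b) (monomial p a) ≤ monomial p a * point-weight a (tabulate b)
  scaled-decay {k} {p} dp a b d≤N x<y = begin
    (4 ^ N) ^ k * g     ≡⟨ cong (_* g) 4^Nk≡ ⟩
    4 ^ s * R * g       ≡⟨ solve 3 (λ u r z → u :* r :* z := r :* (u :* z)) refl (4 ^ s) R g ⟩
    R * (4 ^ s * g)     ≤⟨ *-monoʳ-≤ R (gcd-decay dp a b x<y) ⟩
    R * (3 ^ s * y)     ≡⟨ solve 3 (λ u r z → r :* (u :* z) := z :* (u :* r)) refl (3 ^ s) R y ⟩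
    y * (3 ^ s * R)     ≡⟨ cong (y *_) weight≡ ⟨
    y * point-weight a (tabulate b) ∎
    where
    open ≤-Reasoning
    d = λ i → ∣ a i - b i ∣
    s = dist₁ a b
    R = prodFin (λ i → 4 ^ (N ∸ d i))
    g = gcd (monomial p b) (monomial p a)
    y = monomial p a
    4^Nk≡ : (4 ^ N) ^ k ≡ 4 ^ s * R
    4^Nk≡ = begin-equality
      (4 ^ N) ^ k                          ≡⟨ prodFin-const k (4 ^ N) ⟨
      prodFin {k} (λ _ → 4 ^ N)            ≡⟨ prodFin-cong (λ i → trans (sym (^-distribˡ-+-* 4 (d i) (N ∸ d i)))
                                                  (cong (4 ^_) (m+[n∸m]≡n (d≤N i)))) ⟨
      prodFin (λ i → 4 ^ d i * 4 ^ (N ∸ d i)) ≡⟨ prodFin-* (λ i → 4 ^ d i) (λ i → 4 ^ (N ∸ d i)) ⟩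
      prodFin (λ i → 4 ^ d i) * R          ≡⟨ cong (_* R) (prodFin-^ 4 d) ⟩
      4 ^ s * R                            ∎
    weight≡ : point-weight a (tabulate b) ≡ 3 ^ s * R
    weight≡ = begin-equality
      point-weight a (tabulate b)          ≡⟨ prodFin-cong (λ i → cong (weight-from (a i)) (lookup∘tabulate b i)) ⟩
      prodFin (λ i → 3 ^ d i * 4 ^ (N ∸ d i)) ≡⟨ prodFin-* (λ i → 3 ^ d i) (λ i → 4 ^ (N ∸ d i)) ⟩
      prodFin (λ i → 3 ^ d i) * R          ≡⟨ cong (_* R) (prodFin-^ 3 d) ⟩
      3 ^ s * R                            ∎

gcd-sum-bound : ∀ {k} {p : Fin k → ℕ} → DistinctPrimes k p → (e : ℕ → Fin k → ℕ) →
  StrictlyIncreasing (monomial p ∘ e) → ∀ n →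
  sum< n (λ m → gcd (monomial p (e m)) (monomial p (e n))) ≤ 7 ^ k * monomial p (e n)
gcd-sum-bound {k} {p} dp@(ps , _) e inc n = *-cancelˡ-≤ K {{K≢0}} (begin
  K * sum< n g                ≡⟨ sum<-*ˡ K n g ⟩
  sum< n (λ m → K * g m)      ≤⟨ sum<-mono n term≤ ⟩
  sum< n (λ m → y * w (v m))  ≡⟨ sum<-*ˡ y n (w ∘ v) ⟨
  y * sum< n (w ∘ v)          ≤⟨ *-monoʳ-≤ y (sum-injective≤ v n (box k) v∈box v-injective) ⟩
  y * sum (map w (box k))     ≤⟨ *-monoʳ-≤ y (box-sum≤ a a≤y) ⟩
  y * (7 ^ k * K)             ≡⟨ solve 3 (λ u c z → u :* (c :* z) := z :* (c :* u)) refl y (7 ^ k) K ⟩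
  K * (7 ^ k * y)             ∎)
  where
  open ≤-Reasoning
  -- all exponents of q_0, …, q_n are below N = q_n, so we work with the weights for that N
  a = e n
  y = monomial p a
  open Weights y
  w = point-weight a
  open InjectiveSum (≡-dec _≟_) w
  K = (4 ^ y) ^ k
  K≢0 : NonZero K
  K≢0 = m^n≢0 (4 ^ y) k {{m^n≢0 4 y}}
  g = λ m → gcd (monomial p (e m)) y
  v = λ m → tabulate (e m)
  p≥2 : ∀ i → 2 ≤ p i
  p≥2 i = prime≥2 (ps i)
  a≤y : ∀ i → a i ≤ y
  a≤y i = <⇒≤ (exponent<monomial p≥2 a i)
  e<y : ∀ {m} → m < n → ∀ i → e m i < y
  e<y {m} m<n i = <-trans (exponent<monomial p≥2 (e m) i) (inc m<n)
  term≤ : ∀ m → m < n → K * g m ≤ y * w (v m)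
  term≤ m m<n = scaled-decay dp a (e m)
    (λ i → ≤-trans (∣m-n∣≤m⊔n (a i) (e m i)) (⊔-lub (a≤y i) (<⇒≤ (e<y m<n i)))) (inc m<n)
  v∈box : ∀ m → m < n → v m ∈ box k
  v∈box m m<n = ∈-box (e m) (e<y m<n)
  v-injective : ∀ {m m′} → m < m′ → m′ < n → v m ≢ v m′
  v-injective {m} {m′} m<m′ _ v≡ = <-irrefl (monomial-cong p e≗) (inc m<m′)
    where
    e≗ : ∀ i → e m i ≡ e m′ i
    e≗ i = trans (sym (lookup∘tabulate (e m) i))
             (trans (cong (λ t → lookup t i) v≡) (lookup∘tabulate (e m′) i))

A-gcd-sum-bound : ∀ {k} {p : Fin k → ℕ} → DistinctPrimes k p →
  (q : ℕ → ℕ) → (∀ n → InA p (q n)) → StrictlyIncreasing q →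
  ∀ n → sum< n (λ m → gcd (q m) (q n)) ≤ 7 ^ k * q n
A-gcd-sum-bound {k} {p} dp q q∈A q-inc n =
  subst₂ (λ S z → S ≤ 7 ^ k * z)
    (sum<-cong n (λ m → sym (cong₂ gcd (q≡ m) (q≡ n)))) (sym (q≡ n))
    (gcd-sum-bound dp e (λ m<m′ → subst₂ _<_ (q≡ _) (q≡ _) (q-inc m<m′)) n)
  where
  e = λ m → proj₁ (q∈A m)
  q≡ : ∀ m → q m ≡ monomial p (e m)
  q≡ m = proj₂ (q∈A m)

+-common-denominator : ∀ u v y →
  mkℚᵘ (ℤ.+ u) y ℚᵘ.+ mkℚᵘ (ℤ.+ v) y ℚᵘ.≃ mkℚᵘ (ℤ.+ (u + v)) y
+-common-denominator u v y = *≡* (begin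
  (ℤ.+ u ℤ.* ℤ.+ Y ℤ.+ ℤ.+ v ℤ.* ℤ.+ Y) ℤ.* ℤ.+ Y
    ≡⟨ cong₂ (λ s t → (s ℤ.+ t) ℤ.* ℤ.+ Y) (ℤP.pos-* u Y) (ℤP.pos-* v Y) ⟨
  (ℤ.+ (u * Y) ℤ.+ ℤ.+ (v * Y)) ℤ.* ℤ.+ Y
    ≡⟨ cong (ℤ._* ℤ.+ Y) (ℤP.pos-+ (u * Y) (v * Y)) ⟨
  ℤ.+ (u * Y + v * Y) ℤ.* ℤ.+ Y
    ≡⟨ ℤP.pos-* (u * Y + v * Y) Y ⟨
  ℤ.+ ((u * Y + v * Y) * Y)
    ≡⟨ cong ℤ.+_ (solve 3 (λ s t z → (s :* z :+ t :* z) :* z := (s :+ t) :* (z :* z)) refl u v Y) ⟩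
  ℤ.+ ((u + v) * (Y * Y))
    ≡⟨ ℤP.pos-* (u + v) (Y * Y) ⟩
  ℤ.+ (u + v) ℤ.* ℤ.+ (Y * Y) ∎)
  where
  open ≡-Reasoning
  Y = suc y

sumℚ-ratio≃ : ∀ y (g : ℕ → ℕ) n →
  Q.toℚᵘ (sumℚ n (λ m → ratio (g m) (suc y))) ℚᵘ.≃ mkℚᵘ (ℤ.+ sum< n g) y
sumℚ-ratio≃ y g zero    = *≡* refl
sumℚ-ratio≃ y g (suc n) = ℚᵘP.≃-trans (QP.toℚᵘ-homo-+ (sumℚ n _) (ratio (g n) (suc y)))
  (ℚᵘP.≃-trans (ℚᵘP.+-cong (sumℚ-ratio≃ y g n) (QP.toℚᵘ-fromℚᵘ (mkℚᵘ (ℤ.+ g n) y)))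
    (+-common-denominator (sum< n g) (g n) y))

sumℚ-ratio≤ : ∀ (g : ℕ → ℕ) n {Y C} → 0 < Y → sum< n g ≤ C * Y →
  sumℚ n (λ m → ratio (g m) Y) Q.≤ ℤ.+ C Q./ 1
sumℚ-ratio≤ g n {suc y} {C} _ S≤CY = QP.toℚᵘ-cancel-≤
  (ℚᵘP.≤-respˡ-≃ (ℚᵘP.≃-sym (sumℚ-ratio≃ y g n))
    (ℚᵘP.≤-respʳ-≃ (ℚᵘP.≃-sym (QP.toℚᵘ-fromℚᵘ (mkℚᵘ (ℤ.+ C) 0))) (*≤* cross)))
  where
  cross : ℤ.+ sum< n g ℤ.* ℤ.+ 1 ℤ.≤ ℤ.+ C ℤ.* ℤ.+ suc y
  cross = subst₂ ℤ._≤_ (ℤP.pos-* (sum< n g) 1) (ℤP.pos-* C (suc y))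
    (ℤ.+≤+ (subst (_≤ C * suc y) (sym (*-identityʳ (sum< n g))) S≤CY))

theorem5 : (k : ℕ) → ∃ λ (C : ℕ) →
    (p : Fin k → ℕ) → DistinctPrimes k p →
    (q : ℕ → ℕ) → ((n : ℕ) → InA p (q n)) → StrictlyIncreasing q →
    (n : ℕ) → 1 ≤ n →
    sumℚ n (λ m → ratio (gcd (q m) (q n)) (q n)) Q.≤ (Q._/_ (Data.Integer.+ C) 1)
theorem5 k = 7 ^ k , λ p dp q q∈A q-inc n _ →
  sumℚ-ratio≤ (λ m → gcd (q m) (q n)) n {C = 7 ^ k}
    (InA⇒>0 (proj₁ dp) (q∈A n)) (A-gcd-sum-bound dp q q∈A q-inc n)
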